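{- Let $m\ge 2$ and $t\ge 1$ be integers, and let $I_2(m)$ be the dihedral Coxeter group. Let $E^{I_2(m)}_{T,\ell}(t)$ denote the expected Coxeter length $\ell(r_1\cdots r_t)$ of a product of $t$ reflections $r_1,\dots,r_t$ chosen independently and uniformly at random from the set $T$ of reflections of $I_2(m)$. Then \[ E^{I_2(m)}_{T,\ell}(t)=\begin{cases}\dfrac{m}{2} & \text{if $m$ is even},\\[2mm] \dfrac{m}{2}-\dfrac{(-1)^t}{2m} & \text{if $m$ is odd.}\end{cases} \]
   Context: The dihedral group $I_2(m)$ is the Coxeter group with presentation $\langle s_1,s_2 \mid s_1^2=s_2^2=(s_1s_2)^m=\mathrm{id}\rangle$, with set of simple reflections $S=\{s_1,s_2\}$. The reflections are the elements conjugate to some simple reflection; $T$ denotes the set of reflections. The length $\ell(w)$ is the minimal number of simple reflections whose product is $w$. For a monoid $M$, a nonempty finite subset $R\subseteq M$ and a function $\varphi:M\to\{0,1,2,\dots\}$, $E^M_{R,\varphi}(t):=|R|^{ -t}\sum_{r_1,\dots,r_t\in R}\varphi(r_1\cdots r_t)$. -}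

module Defs where

open import Data.Bool using (Bool; true; false; _∧_; _∨_; if_then_else_)
open import Data.Nat using (ℕ; zero; suc; _+_; _∸_; _%_; _≤_; NonZero)
open import Data.Nat.DivMod using (_mod_)
open import Data.Nat.ListAction using (sum)
open import Data.Fin using (Fin; toℕ; fromℕ<)
import Data.Fin.Properties as FinP
open import Data.Integer using (ℤ; +_)
open import Data.Rational using (ℚ; 0ℚ; _/_)
open import Data.Bool.ListAction using (any)
open import Data.List using (List; []; _∷_; map; concatMap; foldr; length; filter; allFin; _++_)
open import Data.Product using (_×_; _,_; Σ; ∃)
open import Relation.Binary.PropositionalEquality using (_≡_)
open import Relation.Nullary.Decidable using (⌊_⌋)
open import Data.Bool.Properties using () renaming (_≟_ to _≟B_)

tuples : {A : Set} → List A → ℕ → List (List A)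
tuples R zero    = [] ∷ []
tuples R (suc t) = concatMap (λ r → map (r ∷_) (tuples R t)) R

prod : {A : Set} → (A → A → A) → A → List A → A
prod _∙_ e = foldr _∙_ e

-- division of an integer by a natural number; only ever used with a
-- nonzero denominator here (R nonempty), the value at 0 is a dummy.
divℕ : ℤ → ℕ → ℚ
divℕ x zero    = 0ℚ
divℕ x (suc n) = x / suc n

E : {A : Set} → (A → A → A) → A → List A → (A → ℕ) → ℕ → ℚ
E _∙_ e R φ t =
  divℕ (+ sum (map (λ rs → φ (prod _∙_ e rs)) (tuples R t))) (length R Data.Nat.^ t)

-- The dihedral group I₂(m) (order 2m), concretely.
-- (false , k) represents ρ^k and (true , k) represents ρ^k s₁,
-- where ρ = s₁ s₂ (rotation of order m).

module _ (m : ℕ) .{{_ : NonZero m}} where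

  modm : ℕ → Fin m
  modm k = k mod m

  I2 : Set
  I2 = Bool × Fin m

  _·_ : I2 → I2 → I2
  (false , a) · (false , b) = false , modm (toℕ a + toℕ b)
  (false , a) · (true  , b) = true  , modm (toℕ a + toℕ b)
  (true  , a) · (false , b) = true  , modm (toℕ a + (m ∸ toℕ b))
  (true  , a) · (true  , b) = false , modm (toℕ a + (m ∸ toℕ b))

  e : I2
  e = false , modm 0

  inv : I2 → I2
  inv (false , a) = false , modm (m ∸ toℕ a)
  inv (true  , a) = true , a

  s₁ : I2
  s₁ = true , modm 0

  s₂ : I2
  s₂ = s₁ · (false , modm 1)     -- s₂ = s₁ ρ, so that s₁ s₂ = ρ

  S : List I2
  S = s₁ ∷ s₂ ∷ []

  elements : List I2
  elements = map (false ,_) (allFin m) ++ map (true ,_) (allFin m)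

  _==_ : I2 → I2 → Bool
  (b , a) == (c , d) = ⌊ b ≟B c ⌋ ∧ ⌊ a FinP.≟ d ⌋

  isReflection : I2 → Bool
  isReflection x = any (λ w → any (λ s → ((w · s) · inv w) == x) S) elements

  T : List I2
  T = filter (λ x → isReflection x Data.Bool.≟ true) elements

  evalWord : List (Fin 2) → I2
  evalWord ws = prod _·_ e (map (λ { Fin.zero → s₁ ; (Fin.suc _) → s₂ }) ws)

  IsCoxeterLength : (I2 → ℕ) → Set
  IsCoxeterLength ℓ =
    (w : I2) → (Σ (List (Fin 2)) λ ws → evalWord ws ≡ w × length ws ≡ ℓ w)
             × ((ws : List (Fin 2)) → evalWord ws ≡ w → ℓ w ≤ length ws)

-- The reflections of I₂(m) are the m elements ρ^a s₁, and left multiplication by any of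
-- them maps the rotations bijectively onto the reflections and vice versa. Summing over
-- the first factor therefore shows that the sum of ℓ(r₁⋯r_t) over all t-tuples of
-- reflections is m^(t-1) times the sum of ℓ over the reflections (t odd) or over the
-- rotations (t even). Putting p = 2k for ρ^k and p = 2k + 1 for ρ^k s₁, the length is
-- min(p, 2m - p): left multiplication by s₁ or s₂ changes this quantity by one, and one of
-- them decreases it. The coset sums are then (m² - (m mod 2)) / 2 for the rotations and
-- (m² + (m mod 2)) / 2 for the reflections, and dividing by m^t gives the formula.

module Submission where

open import Data.Nat using (ℕ)

module FiniteSums where

  open import Data.Fin using (Fin; toℕ) renaming (zero to fzero; suc to fsuc)
  open import Data.List using (List; []; _∷_; _++_; map; tabulate; concatMap)
  open import Data.List.Properties using (map-∘; map-++)
  open import Data.Nat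
  open import Data.Nat.ListAction using (sum)
  open import Data.Nat.ListAction.Properties using (sum-++)
  open import Data.Nat.Properties
  open import Algebra.Properties.CommutativeSemigroup +-commutativeSemigroup
    using () renaming (interchange to +-interchange)
  open import Function using (_∘_)
  open import Relation.Binary.PropositionalEquality
  open import Defs using (tuples; prod)

  sumBelow : ℕ → (ℕ → ℕ) → ℕ
  sumBelow zero    f = 0
  sumBelow (suc k) f = f 0 + sumBelow k (f ∘ suc)

  sumFin : (k : ℕ) → (Fin k → ℕ) → ℕ
  sumFin zero    f = 0
  sumFin (suc k) f = f fzero + sumFin k (f ∘ fsuc)

  sumFin-cong : ∀ k {f g : Fin k → ℕ} → (∀ i → f i ≡ g i) → sumFin k f ≡ sumFin k g
  sumFin-cong zero    f≗g = refl
  sumFin-cong (suc k) f≗g = cong₂ _+_ (f≗g fzero) (sumFin-cong k (f≗g ∘ fsuc))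

  sumBelow-cong : ∀ k {f g : ℕ → ℕ} → (∀ i → i < k → f i ≡ g i) → sumBelow k f ≡ sumBelow k g
  sumBelow-cong zero    f≗g = refl
  sumBelow-cong (suc k) f≗g = cong₂ _+_ (f≗g 0 z<s) (sumBelow-cong k (λ i i<k → f≗g (suc i) (s<s i<k)))

  sumFin-toℕ : ∀ k (f : ℕ → ℕ) → sumFin k (f ∘ toℕ) ≡ sumBelow k f
  sumFin-toℕ zero    f = refl
  sumFin-toℕ (suc k) f = cong (f 0 +_) (sumFin-toℕ k (f ∘ suc))

  sumFin-const : ∀ k c → sumFin k (λ _ → c) ≡ k * c
  sumFin-const zero    c = refl
  sumFin-const (suc k) c = cong (c +_) (sumFin-const k c)

  sumBelow-const : ∀ k c → sumBelow k (λ _ → c) ≡ k * c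
  sumBelow-const zero    c = refl
  sumBelow-const (suc k) c = cong (c +_) (sumBelow-const k c)

  sumBelow-+ : ∀ k (f g : ℕ → ℕ) → sumBelow k (λ i → f i + g i) ≡ sumBelow k f + sumBelow k g
  sumBelow-+ zero    f g = refl
  sumBelow-+ (suc k) f g = begin
    f 0 + g 0 + sumBelow k (λ i → f (suc i) + g (suc i))
      ≡⟨ cong (f 0 + g 0 +_) (sumBelow-+ k (f ∘ suc) (g ∘ suc)) ⟩
    f 0 + g 0 + (sumBelow k (f ∘ suc) + sumBelow k (g ∘ suc))
      ≡⟨ +-interchange (f 0) (g 0) _ _ ⟩
    f 0 + sumBelow k (f ∘ suc) + (g 0 + sumBelow k (g ∘ suc)) ∎
    where open ≡-Reasoning

  sumBelow-2+ : ∀ k (f : ℕ → ℕ) → sumBelow k (λ i → 2 + f i) ≡ k * 2 + sumBelow k f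
  sumBelow-2+ k f = trans (sumBelow-+ k (λ _ → 2) f) (cong (_+ sumBelow k f) (sumBelow-const k 2))

  sumBelow-snoc : ∀ k (f : ℕ → ℕ) → sumBelow (suc k) f ≡ sumBelow k f + f k
  sumBelow-snoc zero    f = +-comm (f 0) 0
  sumBelow-snoc (suc k) f = trans (cong (f 0 +_) (sumBelow-snoc k (f ∘ suc))) (sym (+-assoc (f 0) _ _))

  sumBelow-reverse : ∀ k (f : ℕ → ℕ) → sumBelow k (λ i → f (k ∸ i)) ≡ sumBelow k (f ∘ suc)
  sumBelow-reverse zero    f = refl
  sumBelow-reverse (suc k) f = begin
    f (suc k) + sumBelow k (λ i → f (k ∸ i)) ≡⟨ cong (f (suc k) +_) (sumBelow-reverse k f) ⟩
    f (suc k) + sumBelow k (f ∘ suc)         ≡⟨ +-comm (f (suc k)) _ ⟩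
    sumBelow k (f ∘ suc) + f (suc k)         ≡⟨ sumBelow-snoc k (f ∘ suc) ⟨
    sumBelow (suc k) (f ∘ suc)               ∎
    where open ≡-Reasoning

  sumBelow-periodic : ∀ k (h : ℕ → ℕ) → (∀ x → h (x + k) ≡ h x) →
                      ∀ j → sumBelow k (λ i → h (j + i)) ≡ sumBelow k h
  sumBelow-periodic k h periodic zero    = refl
  sumBelow-periodic k h periodic (suc j) = trans shift (sumBelow-periodic k h periodic j)
    where
    shift : sumBelow k (λ i → h (suc j + i)) ≡ sumBelow k (λ i → h (j + i))
    shift = +-cancelˡ-≡ (h (j + 0)) _ _ (begin
      h (j + 0) + sumBelow k (λ i → h (suc j + i))
        ≡⟨ cong (h (j + 0) +_) (sumBelow-cong k (λ i _ → cong h (sym (+-suc j i)))) ⟩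
      sumBelow (suc k) (λ i → h (j + i))
        ≡⟨ sumBelow-snoc k (λ i → h (j + i)) ⟩
      sumBelow k (λ i → h (j + i)) + h (j + k)
        ≡⟨ cong (sumBelow k (λ i → h (j + i)) +_) (trans (periodic j) (cong h (sym (+-identityʳ j)))) ⟩
      sumBelow k (λ i → h (j + i)) + h (j + 0)
        ≡⟨ +-comm _ (h (j + 0)) ⟩
      h (j + 0) + sumBelow k (λ i → h (j + i)) ∎)
      where open ≡-Reasoning

  sum-map-tabulate : ∀ {A : Set} k (g : Fin k → A) (f : A → ℕ) → sum (map f (tabulate g)) ≡ sumFin k (f ∘ g)
  sum-map-tabulate zero    g f = refl
  sum-map-tabulate (suc k) g f = cong (f (g fzero) +_) (sum-map-tabulate k (g ∘ fsuc) f)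

  module _ {A : Set} (_∙_ : A → A → A) (ε : A) where

    sumOverTuples : List A → ℕ → (A → ℕ) → ℕ
    sumOverTuples R t φ = sum (map (φ ∘ prod _∙_ ε) (tuples R t))

    private
      sumOverTuples-extend : ∀ R t φ Q →
        sum (map (φ ∘ prod _∙_ ε) (concatMap (λ r → map (r ∷_) (tuples R t)) Q))
          ≡ sum (map (λ r → sumOverTuples R t (φ ∘ (r ∙_))) Q)
      sumOverTuples-extend R t φ []      = refl
      sumOverTuples-extend R t φ (r ∷ Q) = begin
        sum (map g (map (r ∷_) (tuples R t) ++ concatMap h Q))
          ≡⟨ cong sum (map-++ g (map (r ∷_) (tuples R t)) (concatMap h Q)) ⟩
        sum (map g (map (r ∷_) (tuples R t)) ++ map g (concatMap h Q))
          ≡⟨ sum-++ (map g (map (r ∷_) (tuples R t))) _ ⟩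
        sum (map g (map (r ∷_) (tuples R t))) + sum (map g (concatMap h Q))
          ≡⟨ cong₂ _+_ (cong sum (sym (map-∘ (tuples R t)))) (sumOverTuples-extend R t φ Q) ⟩
        sumOverTuples R t (φ ∘ (r ∙_)) + sum (map (λ r → sumOverTuples R t (φ ∘ (r ∙_))) Q) ∎
        where
        open ≡-Reasoning
        g = φ ∘ prod _∙_ ε
        h = λ r → map (r ∷_) (tuples R t)

    sumOverTuples-suc : ∀ R t φ →
      sumOverTuples R (suc t) φ ≡ sum (map (λ r → sumOverTuples R t (φ ∘ (r ∙_))) R)
    sumOverTuples-suc R t φ = sumOverTuples-extend R t φ R

module CycleDistance where

  open import Data.Nat
  open import Data.Nat.Properties
  open import Data.Nat.Tactic.RingSolver using (solve-∀)
  open import Data.Sum using (_⊎_; inj₁; inj₂)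
  open import Function using (_∘_)
  open import Relation.Nullary using (yes; no)
  open import Relation.Nullary.Negation using (contradiction)
  open import Relation.Binary.PropositionalEquality
  open FiniteSums

  -- The distance from p to 0 on a cycle of length N, for p ≤ N.
  cycleDist : ℕ → ℕ → ℕ
  cycleDist N p = p ⊓ (N ∸ p)

  cycleDist≡suc⇒0< : ∀ {N p d} → cycleDist N p ≡ suc d → 0 < p
  cycleDist≡suc⇒0< {p = suc _} _ = z<s

  module _ {N : ℕ} where

    cycleDist-sym : ∀ {p q} → p + q ≡ N → cycleDist N p ≡ cycleDist N q
    cycleDist-sym {p} {q} p+q≡N = begin
      p ⊓ (N ∸ p)       ≡⟨ cong (cycleDist N) p≡N∸q ⟩
      (N ∸ q) ⊓ (N ∸ (N ∸ q)) ≡⟨ cong ((N ∸ q) ⊓_) (m∸[m∸n]≡n q≤N) ⟩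
      (N ∸ q) ⊓ q       ≡⟨ ⊓-comm (N ∸ q) q ⟩
      q ⊓ (N ∸ q)       ∎
      where
      open ≡-Reasoning
      p≡N∸q : p ≡ N ∸ q
      p≡N∸q = trans (sym (m+n∸n≡m p q)) (cong (_∸ q) p+q≡N)
      q≤N : q ≤ N
      q≤N = subst (q ≤_) (trans (+-comm q p) p+q≡N) (m≤m+n q p)

    cycleDist-suc-≤ : ∀ p → cycleDist N (suc p) ≤ suc (cycleDist N p)
    cycleDist-suc-≤ p = ⊓-monoʳ-≤ (suc p) (≤-trans (∸-monoʳ-≤ N (n≤1+n p)) (n≤1+n (N ∸ p)))

    cycleDist-≤-suc : ∀ p → cycleDist N p ≤ suc (cycleDist N (suc p))
    cycleDist-≤-suc p =
      ⊓-mono-≤ (m≤n+m p 2) (subst (λ x → N ∸ p ≤ suc x) (pred[m∸n]≡m∸[1+n] N p) (n≤1+pred (N ∸ p)))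
      where
      n≤1+pred : ∀ n → n ≤ suc (pred n)
      n≤1+pred zero    = z≤n
      n≤1+pred (suc n) = ≤-refl

    cycleDist-descent : ∀ p d → cycleDist N p ≡ suc d → cycleDist N (pred p) ≡ d ⊎ cycleDist N (suc p) ≡ d
    cycleDist-descent p d dist≡ with p ≤? N ∸ p
    ... | yes p≤N∸p = inj₁ (trans (m≤n⇒m⊓n≡m d≤N∸d) d≡pred-p)
      where
      d≡pred-p : pred p ≡ d
      d≡pred-p = cong pred (trans (sym (m≤n⇒m⊓n≡m p≤N∸p)) dist≡)
      d≤N∸d : pred p ≤ N ∸ pred p
      d≤N∸d = ≤-trans (≤⇒pred≤ p≤N∸p) (∸-monoʳ-≤ N (pred[n]≤n {p}))
    ... | no p≰N∸p = inj₂ (trans (m≥n⇒m⊓n≡n N∸p≤p) N∸suc-p≡d)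
      where
      N∸p<p : N ∸ p < p
      N∸p<p = ≰⇒> p≰N∸p
      N∸suc-p≡d : N ∸ suc p ≡ d
      N∸suc-p≡d = trans (sym (pred[m∸n]≡m∸[1+n] N p))
                        (cong pred (trans (sym (m≥n⇒m⊓n≡n (<⇒≤ N∸p<p))) dist≡))
      N∸p≤p : N ∸ suc p ≤ suc p
      N∸p≤p = ≤-trans (∸-monoʳ-≤ N (n≤1+n p)) (≤-trans (<⇒≤ N∸p<p) (n≤1+n p))

    cycleDist≡0⇒≡0 : ∀ {p} → p < N → cycleDist N p ≡ 0 → p ≡ 0
    cycleDist≡0⇒≡0 {p} p<N dist≡0 with ⊓-sel p (N ∸ p)
    ... | inj₁ ⊓≡p = trans (sym ⊓≡p) dist≡0
    ... | inj₂ ⊓≡N∸p = contradiction (m∸n≡0⇒m≤n (trans (sym ⊓≡N∸p) dist≡0)) (<⇒≱ p<N)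

  cycleDist-self : ∀ N → cycleDist N N ≡ 0
  cycleDist-self N = trans (cong (N ⊓_) (n∸n≡0 N)) (⊓-zeroʳ N)

  cycleDist-2+ : ∀ m j → j ≤ m + m → cycleDist (2 + m + (2 + m)) (2 + j) ≡ 2 + cycleDist (m + m) j
  cycleDist-2+ m j j≤2m rewrite +-suc m (suc m) | +-suc m m | +-∸-assoc 2 j≤2m = refl

  rotationDistSum reflectionDistSum : ℕ → ℕ
  rotationDistSum   m = sumBelow m (λ i → cycleDist (m + m) (i + i))
  reflectionDistSum m = sumBelow m (λ i → cycleDist (m + m) (suc (i + i)))

  private
    double-suc : ∀ i → suc i + suc i ≡ 2 + (i + i)
    double-suc i = cong suc (+-suc i i)

    double-mono : ∀ {i m} → i ≤ m → i + i ≤ m + m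
    double-mono i≤m = +-mono-≤ i≤m i≤m

  rotationDistSum-2+ : ∀ m → rotationDistSum (2 + m) ≡ suc m * 2 + rotationDistSum m
  rotationDistSum-2+ m = begin
    sumBelow (suc m) (λ i → cycleDist M (suc i + suc i))
      ≡⟨ sumBelow-cong (suc m) (λ i i<1+m → trans (cong (cycleDist M) (double-suc i))
                                                  (cycleDist-2+ m (i + i) (double-mono (s≤s⁻¹ i<1+m)))) ⟩
    sumBelow (suc m) (λ i → 2 + f i)            ≡⟨ sumBelow-2+ (suc m) f ⟩
    suc m * 2 + sumBelow (suc m) f              ≡⟨ cong (suc m * 2 +_) (sumBelow-snoc m f) ⟩
    suc m * 2 + (rotationDistSum m + f m)       ≡⟨ cong (λ x → suc m * 2 + (rotationDistSum m + x)) (cycleDist-self (m + m)) ⟩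
    suc m * 2 + (rotationDistSum m + 0)         ≡⟨ cong (suc m * 2 +_) (+-identityʳ _) ⟩
    suc m * 2 + rotationDistSum m               ∎
    where
    open ≡-Reasoning
    M = 2 + m + (2 + m)
    f = λ i → cycleDist (m + m) (i + i)

  reflectionDistSum-2+ : ∀ m → reflectionDistSum (2 + m) ≡ 1 + (m * 2 + reflectionDistSum m + 1)
  reflectionDistSum-2+ m = cong suc (begin
    sumBelow (suc m) (λ i → cycleDist M (suc (suc i + suc i)))
      ≡⟨ sumBelow-snoc m _ ⟩
    sumBelow m (λ i → cycleDist M (suc (suc i + suc i))) + cycleDist M (suc (suc m + suc m))
      ≡⟨ cong₂ _+_ (sumBelow-cong m (λ i i<m → trans (cong (cycleDist M ∘ suc) (double-suc i))
                                                     (cycleDist-2+ m (suc (i + i)) (odd≤ i<m))))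
                   last≡1 ⟩
    sumBelow m (λ i → 2 + f i) + 1              ≡⟨ cong (_+ 1) (sumBelow-2+ m f) ⟩
    m * 2 + reflectionDistSum m + 1             ∎)
    where
    open ≡-Reasoning
    M = 2 + m + (2 + m)
    f = λ i → cycleDist (m + m) (suc (i + i))
    odd≤ : ∀ {i} → i < m → suc (i + i) ≤ m + m
    odd≤ {i} i<m = ≤-trans (+-monoˡ-≤ i i<m) (+-monoʳ-≤ m (<⇒≤ i<m))
    last≡1 : cycleDist M (suc (suc m + suc m)) ≡ 1
    last≡1 rewrite +-suc m (suc m) | +-suc m m | m+n∸n≡m 1 (m + m) = cong suc (⊓-zeroʳ (suc (suc (m + m))))

  rotationDistSum-closed : ∀ m → rotationDistSum m * 2 + m % 2 ≡ m * m
  rotationDistSum-closed zero          = refl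
  rotationDistSum-closed (suc zero)    = refl
  rotationDistSum-closed (suc (suc m)) = begin
    rotationDistSum (2 + m) * 2 + m % 2        ≡⟨ cong (λ x → x * 2 + m % 2) (rotationDistSum-2+ m) ⟩
    (suc m * 2 + rotationDistSum m) * 2 + m % 2 ≡⟨ regroup (rotationDistSum m) (m % 2) m ⟩
    (rotationDistSum m * 2 + m % 2) + 4 * suc m ≡⟨ cong (_+ 4 * suc m) (rotationDistSum-closed m) ⟩
    m * m + 4 * suc m                          ≡⟨ square-2+ m ⟩
    (2 + m) * (2 + m)                          ∎
    where
    open ≡-Reasoning
    regroup : ∀ s r m → (suc m * 2 + s) * 2 + r ≡ (s * 2 + r) + 4 * suc m
    regroup = solve-∀
    square-2+ : ∀ m → m * m + 4 * suc m ≡ (2 + m) * (2 + m)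
    square-2+ = solve-∀

  reflectionDistSum-closed : ∀ m → reflectionDistSum m * 2 ≡ m * m + m % 2
  reflectionDistSum-closed zero          = refl
  reflectionDistSum-closed (suc zero)    = refl
  reflectionDistSum-closed (suc (suc m)) = begin
    reflectionDistSum (2 + m) * 2                   ≡⟨ cong (_* 2) (reflectionDistSum-2+ m) ⟩
    (1 + (m * 2 + reflectionDistSum m + 1)) * 2     ≡⟨ regroup (reflectionDistSum m) m ⟩
    reflectionDistSum m * 2 + 4 * suc m             ≡⟨ cong (_+ 4 * suc m) (reflectionDistSum-closed m) ⟩
    m * m + m % 2 + 4 * suc m                       ≡⟨ square-2+ m (m % 2) ⟩
    (2 + m) * (2 + m) + m % 2                       ∎
    where
    open ≡-Reasoning
    regroup : ∀ s m → (1 + (m * 2 + s + 1)) * 2 ≡ s * 2 + 4 * suc m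
    regroup = solve-∀
    square-2+ : ∀ m r → m * m + r + 4 * suc m ≡ (2 + m) * (2 + m) + r
    square-2+ = solve-∀

module Fractions where

  open import Data.Nat as ℕ using (ℕ; suc; NonZero)
  import Data.Nat.Properties as ℕ
  import Data.Nat.Tactic.RingSolver as ℕSolver
  open import Data.Integer as ℤ using (ℤ; +_; 1ℤ)
  open import Data.Integer.Properties using (pos-*; pos-+)
  import Data.Integer.Tactic.RingSolver as ℤSolver
  open import Data.Rational using (_/_; _-_; _*_; toℚᵘ)
  open import Data.Rational.Properties
    using (toℚᵘ-injective; toℚᵘ-fromℚᵘ; toℚᵘ-homo-+; toℚᵘ-homo-*; toℚᵘ-homo‿-)
  import Data.Rational.Unnormalised as ℚᵘ
  open ℚᵘ using (mkℚᵘ; *≡*)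
  open import Data.Rational.Unnormalised.Properties using (≃-trans; ≃-sym; +-cong; -‿cong; *-cong)
  open import Relation.Binary.PropositionalEquality
  open import Defs using (divℕ)

  divℕ≡/ : ∀ z d .{{_ : NonZero d}} → divℕ z d ≡ z / d
  divℕ≡/ z (suc d) = refl

  /-≡ : ∀ (p q : ℤ) b d .{{_ : NonZero b}} .{{_ : NonZero d}} → p ℤ.* + d ≡ q ℤ.* + b → p / b ≡ q / d
  /-≡ p q (suc b) (suc d) eq = toℚᵘ-injective
    (≃-trans (toℚᵘ-fromℚᵘ (mkℚᵘ p b)) (≃-trans (*≡* eq) (≃-sym (toℚᵘ-fromℚᵘ (mkℚᵘ q d)))))

  divℕ-cancelʳ : ∀ a b k .{{_ : NonZero k}} .{{_ : NonZero b}} → divℕ (+ (k ℕ.* a)) (b ℕ.* k) ≡ (+ a) / b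
  divℕ-cancelʳ a b k = trans (divℕ≡/ _ (b ℕ.* k) {{ℕ.m*n≢0 b k}})
    (/-≡ (+ (k ℕ.* a)) (+ a) (b ℕ.* k) b {{ℕ.m*n≢0 b k}} (begin
      + (k ℕ.* a) ℤ.* + b   ≡⟨ pos-* (k ℕ.* a) b ⟨
      + (k ℕ.* a ℕ.* b)     ≡⟨ cong +_ (rearrange k a b) ⟩
      + (a ℕ.* (b ℕ.* k))   ≡⟨ pos-* a (b ℕ.* k) ⟩
      + a ℤ.* + (b ℕ.* k)   ∎))
    where
    open ≡-Reasoning
    rearrange : ∀ k a b → k ℕ.* a ℕ.* b ≡ a ℕ.* (b ℕ.* k)
    rearrange = ℕSolver.solve-∀

  half-square : ∀ x m .{{_ : NonZero m}} → x ℕ.* 2 ≡ m ℕ.* m → (+ x) / m ≡ (+ m) / 2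
  half-square x m x*2≡m*m = /-≡ (+ x) (+ m) m 2 (begin
    + x ℤ.* + 2     ≡⟨ pos-* x 2 ⟨
    + (x ℕ.* 2)     ≡⟨ cong +_ x*2≡m*m ⟩
    + (m ℕ.* m)     ≡⟨ pos-* m m ⟩
    + m ℤ.* + m     ∎)
    where open ≡-Reasoning

  half-square-shifted : ∀ x m a b .{{_ : NonZero m}} → x ℕ.* 2 ℕ.+ a ≡ m ℕ.* m ℕ.+ b →
    (+ x) / m ≡ (+ m) / 2 - ((+ a ℤ.- + b) / 2) * (1ℤ / m)
  half-square-shifted x (suc k) a b eq = toℚᵘ-injective (≃-trans
    (toℚᵘ-fromℚᵘ (mkℚᵘ (+ x) k))
    (≃-trans (*≡* cross) (≃-sym toℚᵘ-rhs)))
    where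
    m = + suc k
    v = + a ℤ.- + b
    -- in ℚᵘ the right-hand side is the unreduced fraction (2m·m - 2v) / 4m
    toℚᵘ-rhs : toℚᵘ (m / 2 - (v / 2) * (1ℤ / suc k))
               ℚᵘ.≃ mkℚᵘ m 1 ℚᵘ.+ ℚᵘ.- (mkℚᵘ v 1 ℚᵘ.* mkℚᵘ 1ℤ k)
    toℚᵘ-rhs = ≃-trans (toℚᵘ-homo-+ (m / 2) _)
      (+-cong (toℚᵘ-fromℚᵘ (mkℚᵘ m 1))
        (≃-trans (toℚᵘ-homo‿- _)
          (-‿cong (≃-trans (toℚᵘ-homo-* (v / 2) (1ℤ / suc k))
            (*-cong (toℚᵘ-fromℚᵘ (mkℚᵘ v 1)) (toℚᵘ-fromℚᵘ (mkℚᵘ 1ℤ k)))))))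
    eqℤ : + x ℤ.* + 2 ℤ.+ + a ≡ m ℤ.* m ℤ.+ + b
    eqℤ = begin
      + x ℤ.* + 2 ℤ.+ + a   ≡⟨ cong (ℤ._+ + a) (pos-* x 2) ⟨
      + (x ℕ.* 2) ℤ.+ + a   ≡⟨ pos-+ (x ℕ.* 2) a ⟨
      + (x ℕ.* 2 ℕ.+ a)     ≡⟨ cong +_ eq ⟩
      + (suc k ℕ.* suc k ℕ.+ b) ≡⟨ pos-+ (suc k ℕ.* suc k) b ⟩
      + (suc k ℕ.* suc k) ℤ.+ + b ≡⟨ cong (ℤ._+ + b) (pos-* (suc k) (suc k)) ⟩
      m ℤ.* m ℤ.+ + b       ∎
      where open ≡-Reasoning
    cross : + x ℤ.* + (2 ℕ.* (2 ℕ.* suc k)) ≡ (m ℤ.* + (2 ℕ.* suc k) ℤ.+ ℤ.- (v ℤ.* 1ℤ) ℤ.* + 2) ℤ.* m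
    cross rewrite pos-* 2 (2 ℕ.* suc k) | pos-* 2 (suc k) = begin
      + x ℤ.* (+ 2 ℤ.* (+ 2 ℤ.* m))                              ≡⟨ expand (+ x) (+ a) m ⟩
      (+ x ℤ.* + 2 ℤ.+ + a) ℤ.* (+ 2 ℤ.* m) ℤ.- + a ℤ.* (+ 2 ℤ.* m)
        ≡⟨ cong (λ y → y ℤ.* (+ 2 ℤ.* m) ℤ.- + a ℤ.* (+ 2 ℤ.* m)) eqℤ ⟩
      (m ℤ.* m ℤ.+ + b) ℤ.* (+ 2 ℤ.* m) ℤ.- + a ℤ.* (+ 2 ℤ.* m)     ≡⟨ collect m (+ a) (+ b) ⟩
      (m ℤ.* (+ 2 ℤ.* m) ℤ.+ ℤ.- (v ℤ.* 1ℤ) ℤ.* + 2) ℤ.* m        ∎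
      where
      open ≡-Reasoning
      expand : ∀ x a m → x ℤ.* (+ 2 ℤ.* (+ 2 ℤ.* m))
                         ≡ (x ℤ.* + 2 ℤ.+ a) ℤ.* (+ 2 ℤ.* m) ℤ.- a ℤ.* (+ 2 ℤ.* m)
      expand = ℤSolver.solve-∀
      collect : ∀ m a b → (m ℤ.* m ℤ.+ b) ℤ.* (+ 2 ℤ.* m) ℤ.- a ℤ.* (+ 2 ℤ.* m)
                          ≡ (m ℤ.* (+ 2 ℤ.* m) ℤ.+ ℤ.- ((a ℤ.- b) ℤ.* 1ℤ) ℤ.* + 2) ℤ.* m
      collect = ℤSolver.solve-∀

module Parity where

  open import Data.Bool using (Bool; true; false; not)
  open import Data.Integer as ℤ using (-1ℤ; 1ℤ)
  open import Data.Nat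
  open import Data.Nat.DivMod using (m%n<n)
  open import Data.Nat.Divisibility using (_∣_; m%n≡0⇒n∣m)
  open import Data.Nat.Properties using (+-suc)
  open import Data.Product using (_×_; _,_; ∃)
  open import Data.Sum using (_⊎_; inj₁; inj₂)
  open import Relation.Nullary using (¬_)
  open import Relation.Nullary.Negation using (contradiction)
  open import Relation.Binary.PropositionalEquality

  even⊎odd : ∀ a → ∃ (λ c → a ≡ c + c) ⊎ ∃ (λ c → a ≡ suc (c + c))
  even⊎odd zero    = inj₁ (0 , refl)
  even⊎odd (suc a) with even⊎odd a
  ... | inj₁ (c , a≡c+c)   = inj₂ (c , cong suc a≡c+c)
  ... | inj₂ (c , a≡1+c+c) = inj₁ (suc c , trans (cong suc a≡1+c+c) (cong suc (sym (+-suc c c))))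

  -- The coset (true: reflections, false: rotations) containing a product of t + 1 reflections.
  productCoset : ℕ → Bool
  productCoset zero    = true
  productCoset (suc t) = not (productCoset t)

  odd⇒%2≡1 : ∀ m → ¬ 2 ∣ m → m % 2 ≡ 1
  odd⇒%2≡1 m 2∤m with m % 2 | m%n<n m 2 | m%n≡0⇒n∣m m 2
  ... | 0 | _              | even = contradiction (even refl) 2∤m
  ... | 1 | _              | _    = refl
  ... | suc (suc _) | s≤s (s≤s ()) | _

  productCoset-sign : ∀ t → (productCoset t ≡ true  × -1ℤ ℤ.^ suc t ≡ -1ℤ)
                          ⊎ (productCoset t ≡ false × -1ℤ ℤ.^ suc t ≡ 1ℤ)
  productCoset-sign zero = inj₁ (refl , refl)
  productCoset-sign (suc t) with productCoset-sign t
  ... | inj₁ (coset≡true  , sign≡) = inj₂ (cong not coset≡true  , cong (-1ℤ ℤ.*_) sign≡)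
  ... | inj₂ (coset≡false , sign≡) = inj₁ (cong not coset≡false , cong (-1ℤ ℤ.*_) sign≡)

module Dihedral (n : ℕ) where

  open import Data.Bool as Bool using (Bool; true; false; not)
  open import Data.Bool.ListAction using (any)
  open import Data.Bool.Properties using (T-≡)
  open import Data.Fin using (Fin; toℕ; fromℕ<) renaming (zero to fzero; suc to fsuc)
  open import Data.Fin.Properties using (toℕ-fromℕ<; toℕ-injective; toℕ<n)
  open import Data.Integer as ℤ using (-1ℤ; 1ℤ)
  open import Data.List using (List; []; _∷_; _++_; map; allFin; filter; length)
  open import Data.List.Properties using (filter-++; filter-all; filter-none; map-∘; length-map; length-tabulate)
  open import Data.List.Relation.Unary.All using (universal)
  open import Data.List.Relation.Unary.All.Properties using (map⁺)
  open import Data.List.Relation.Unary.Any using (here; there; satisfied)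
  open import Data.List.Relation.Unary.Any.Properties using (any⁺; any⁻)
  open import Data.List.Membership.Propositional using (_∈_; lose)
  open import Data.List.Membership.Propositional.Properties using (∈-++⁺ʳ; ∈-map⁺; ∈-allFin)
  open import Data.Nat hiding (_/_)
  open import Data.Nat.DivMod using (m%n<n; m<n⇒m%n≡m; [m+n]%n≡m%n; %-distribˡ-+; m%n%n≡m%n; n%n≡0)
  open import Data.Nat.ListAction using (sum)
  open import Data.Nat.Properties
  open import Data.Nat.Tactic.RingSolver using (solve-∀)
  open import Data.Product using (_×_; _,_; ∃; proj₂)
  open import Data.Rational as ℚ using (_/_)
  open import Data.Sum using (inj₁; inj₂)
  open import Function using (_∘_; id)
  open import Function.Bundles using (Equivalence)
  open import Relation.Binary.PropositionalEquality
  open import Relation.Nullary.Decidable using (fromWitness)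
  open import Defs
  open FiniteSums
  open CycleDistance
  open Fractions
  open Parity


  M : ℕ
  M = 2 + n

  G : Set
  G = I2 M

  _∙_ : G → G → G
  _∙_ = _·_ M

  σ₁ σ₂ : G
  σ₁ = s₁ M
  σ₂ = s₂ M

  md : ℕ → Fin M
  md = modm M

  toℕ-md : ∀ k → toℕ (md k) ≡ k % M
  toℕ-md k = toℕ-fromℕ< (m%n<n k M)

  toℕ-md-< : ∀ {k} → k < M → toℕ (md k) ≡ k
  toℕ-md-< {k} k<M = trans (toℕ-md k) (m<n⇒m%n≡m k<M)

  md-toℕ : ∀ i → md (toℕ i) ≡ i
  md-toℕ i = toℕ-injective (toℕ-md-< (toℕ<n i))

  md-periodic : ∀ x → md (x + M) ≡ md x
  md-periodic x = toℕ-injective (trans (toℕ-md (x + M)) (trans ([m+n]%n≡m%n x M) (sym (toℕ-md x))))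

  md-absorbˡ : ∀ x y → md (toℕ (md x) + y) ≡ md (x + y)
  md-absorbˡ x y = toℕ-injective (begin
    toℕ (md (toℕ (md x) + y))  ≡⟨ toℕ-md (toℕ (md x) + y) ⟩
    (toℕ (md x) + y) % M       ≡⟨ cong (λ z → (z + y) % M) (toℕ-md x) ⟩
    (x % M + y) % M            ≡⟨ %-distribˡ-+ (x % M) y M ⟩
    (x % M % M + y % M) % M    ≡⟨ cong (λ z → (z + y % M) % M) (m%n%n≡m%n x M) ⟩
    (x % M + y % M) % M        ≡⟨ %-distribˡ-+ x y M ⟨
    (x + y) % M                ≡⟨ toℕ-md (x + y) ⟨
    toℕ (md (x + y))           ∎)
    where open ≡-Reasoning

  toℕ-σ₂ : toℕ (proj₂ σ₂) ≡ suc n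
  toℕ-σ₂ = toℕ-md-< ≤-refl

  -- The set of reflections

  conj-σ₁ : ∀ c → ((true , c) ∙ σ₁) ∙ (true , c) ≡ (true , md (toℕ c + toℕ c))
  conj-σ₁ c = cong (true ,_) (begin
    md (toℕ (md (toℕ c + M)) + toℕ c) ≡⟨ md-absorbˡ (toℕ c + M) (toℕ c) ⟩
    md (toℕ c + M + toℕ c)            ≡⟨ cong md (+-comm-last (toℕ c) M) ⟩
    md (toℕ c + toℕ c + M)            ≡⟨ md-periodic (toℕ c + toℕ c) ⟩
    md (toℕ c + toℕ c)                ∎)
    where
    open ≡-Reasoning
    +-comm-last : ∀ c m → c + m + c ≡ c + c + m
    +-comm-last = solve-∀

  conj-σ₂ : ∀ c → ((true , c) ∙ σ₂) ∙ (true , c) ≡ (true , md (suc (toℕ c + toℕ c)))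
  conj-σ₂ c = cong (true ,_) (begin
    md (toℕ (md (toℕ c + (M ∸ toℕ (proj₂ σ₂)))) + toℕ c)
      ≡⟨ cong (λ z → md (toℕ (md (toℕ c + (M ∸ z))) + toℕ c)) toℕ-σ₂ ⟩
    md (toℕ (md (toℕ c + (M ∸ suc n))) + toℕ c)
      ≡⟨ cong (λ z → md (toℕ (md (toℕ c + z)) + toℕ c)) (m+n∸n≡m 1 n) ⟩
    md (toℕ (md (toℕ c + 1)) + toℕ c)                     ≡⟨ md-absorbˡ (toℕ c + 1) (toℕ c) ⟩
    md (toℕ c + 1 + toℕ c)                                ≡⟨ cong md (+-comm-last (toℕ c)) ⟩
    md (suc (toℕ c + toℕ c))                              ∎)
    where
    open ≡-Reasoning
    +-comm-last : ∀ c → c + 1 + c ≡ suc (c + c)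
    +-comm-last = solve-∀

  ==-refl : ∀ x → Bool.T (_==_ M x x)
  ==-refl (false , a) = fromWitness refl
  ==-refl (true  , a) = fromWitness refl

  conjugatesBy : G → G → Bool
  conjugatesBy x w = any (λ s → _==_ M ((w ∙ s) ∙ inv M w) x) (S M)

  rotation-not-reflection : ∀ a → isReflection M (false , a) ≢ true
  rotation-not-reflection a isRefl
    with satisfied (any⁻ (conjugatesBy (false , a)) (elements M) (Equivalence.from T-≡ isRefl))
  ... | (false , _) , ()
  ... | (true  , _) , ()

  -- ρ^(2c) s₁ and ρ^(2c+1) s₁ are the conjugates of σ₁ and σ₂ by the reflection (true , c).
  reflection-as-conjugate : ∀ a → ∃ λ c → ∃ λ s → s ∈ S M × ((true , c) ∙ s) ∙ (true , c) ≡ (true , a)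
  reflection-as-conjugate a with even⊎odd (toℕ a)
  ... | inj₁ (c , a≡c+c) = fromℕ< c<M , σ₁ , here refl , trans (conj-σ₁ (fromℕ< c<M)) (cong (true ,_) md≡a)
    where
    c<M : c < M
    c<M = ≤-<-trans (m≤m+n c c) (subst (_< M) a≡c+c (toℕ<n a))
    md≡a : md (toℕ (fromℕ< c<M) + toℕ (fromℕ< c<M)) ≡ a
    md≡a = trans (cong (λ z → md (z + z)) (toℕ-fromℕ< c<M)) (trans (cong md (sym a≡c+c)) (md-toℕ a))
  ... | inj₂ (c , a≡1+c+c) =
    fromℕ< c<M , σ₂ , there (here refl) , trans (conj-σ₂ (fromℕ< c<M)) (cong (true ,_) md≡a)
    where
    c<M : c < M
    c<M = ≤-<-trans (m≤n+m c (suc c)) (subst (_< M) a≡1+c+c (toℕ<n a))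
    md≡a : md (suc (toℕ (fromℕ< c<M) + toℕ (fromℕ< c<M))) ≡ a
    md≡a = trans (cong (λ z → md (suc (z + z))) (toℕ-fromℕ< c<M)) (trans (cong md (sym a≡1+c+c)) (md-toℕ a))

  reflection-isReflection : ∀ a → isReflection M (true , a) ≡ true
  reflection-isReflection a with reflection-as-conjugate a
  ... | c , s , s∈S , conj≡a = Equivalence.to T-≡
    (any⁺ (conjugatesBy (true , a)) (lose w∈elements
      (any⁺ (λ s → _==_ M (((true , c) ∙ s) ∙ (true , c)) (true , a)) (lose s∈S conj==a))))
    where
    w∈elements : (true , c) ∈ elements M
    w∈elements = ∈-++⁺ʳ (map (false ,_) (allFin M)) (∈-map⁺ (true ,_) (∈-allFin c))
    conj==a : Bool.T (_==_ M (((true , c) ∙ s) ∙ (true , c)) (true , a))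
    conj==a = subst (λ y → Bool.T (_==_ M y (true , a))) (sym conj≡a) (==-refl (true , a))

  reflections : List G
  reflections = map (true ,_) (allFin M)

  T≡reflections : T M ≡ reflections
  T≡reflections = begin
    filter isRefl? (map (false ,_) (allFin M) ++ reflections)
      ≡⟨ filter-++ isRefl? (map (false ,_) (allFin M)) reflections ⟩
    filter isRefl? (map (false ,_) (allFin M)) ++ filter isRefl? reflections
      ≡⟨ cong₂ _++_ (filter-none isRefl? (map⁺ {f = false ,_} (universal rotation-not-reflection (allFin M))))
                    (filter-all isRefl? (map⁺ {f = true ,_} (universal reflection-isReflection (allFin M)))) ⟩
    [] ++ reflections ∎
    where
    open ≡-Reasoning
    isRefl? = λ x → isReflection M x Bool.≟ true

  -- Sums over products of reflections

  -- (true , a) ∙ (b , k) ≡ (not b , mirror a k), and mirror a is k ↦ a - k modulo M.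
  mirror : Fin M → Fin M → Fin M
  mirror a k = md (toℕ a + (M ∸ toℕ k))

  sumFin-mirror : ∀ a (g : Fin M → ℕ) → sumFin M (g ∘ mirror a) ≡ sumFin M g
  sumFin-mirror a g = begin
    sumFin M (λ k → h (c + (M ∸ toℕ k))) ≡⟨ sumFin-toℕ M (λ i → h (c + (M ∸ i))) ⟩
    sumBelow M (λ i → h (c + (M ∸ i)))   ≡⟨ sumBelow-reverse M (λ x → h (c + x)) ⟩
    sumBelow M (λ i → h (c + suc i))     ≡⟨ sumBelow-cong M (λ i _ → cong h (+-suc c i)) ⟩
    sumBelow M (λ i → h (suc c + i))     ≡⟨ sumBelow-periodic M h (cong g ∘ md-periodic) (suc c) ⟩
    sumBelow M h                         ≡⟨ sumFin-toℕ M h ⟨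
    sumFin M (h ∘ toℕ)                   ≡⟨ sumFin-cong M (cong g ∘ md-toℕ) ⟩
    sumFin M g                           ∎
    where
    open ≡-Reasoning
    c = toℕ a
    h = g ∘ md

  cosetSum : Bool → (G → ℕ) → ℕ
  cosetSum b φ = sumFin M (λ k → φ (b , k))

  cosetSum-cong : ∀ b {φ ψ : G → ℕ} → (∀ x → φ x ≡ ψ x) → cosetSum b φ ≡ cosetSum b ψ
  cosetSum-cong b φ≗ψ = sumFin-cong M (λ k → φ≗ψ (b , k))

  cosetSum-reflection∙ : ∀ a b (φ : G → ℕ) → cosetSum b (φ ∘ ((true , a) ∙_)) ≡ cosetSum (not b) φ
  cosetSum-reflection∙ a false φ = sumFin-mirror a (λ k → φ (true , k))
  cosetSum-reflection∙ a true  φ = sumFin-mirror a (λ k → φ (false , k))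

  sum-reflections : ∀ (f : G → ℕ) → sum (map f reflections) ≡ cosetSum true f
  sum-reflections f =
    trans (cong sum (sym (map-∘ {g = f} {f = true ,_} (allFin M)))) (sum-map-tabulate M id (f ∘ (true ,_)))

  sumOverTuples-reflections : ∀ t φ →
    sumOverTuples _∙_ (e M) reflections (suc t) φ ≡ M ^ t * cosetSum (productCoset t) φ
  sumOverTuples-reflections zero φ = begin
    sumOverTuples _∙_ (e M) reflections 1 φ        ≡⟨ sumOverTuples-suc _∙_ (e M) reflections 0 φ ⟩
    sum (map (λ r → φ (r ∙ e M) + 0) reflections)  ≡⟨ sum-reflections (λ r → φ (r ∙ e M) + 0) ⟩
    cosetSum true (λ r → φ (r ∙ e M) + 0)          ≡⟨ sumFin-cong M right-unit ⟩
    cosetSum true φ                                ≡⟨ *-identityˡ _ ⟨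
    1 * cosetSum true φ                            ∎
    where
    open ≡-Reasoning
    right-unit : ∀ k → φ ((true , k) ∙ e M) + 0 ≡ φ (true , k)
    right-unit k = trans (+-identityʳ _) (cong (λ z → φ (true , z)) (trans (md-periodic (toℕ k)) (md-toℕ k)))
  sumOverTuples-reflections (suc t) φ = begin
    sumOverTuples _∙_ (e M) reflections (2 + t) φ
      ≡⟨ sumOverTuples-suc _∙_ (e M) reflections (suc t) φ ⟩
    sum (map (λ r → sumOverTuples _∙_ (e M) reflections (suc t) (φ ∘ (r ∙_))) reflections)
      ≡⟨ sum-reflections (λ r → sumOverTuples _∙_ (e M) reflections (suc t) (φ ∘ (r ∙_))) ⟩
    sumFin M (λ a → sumOverTuples _∙_ (e M) reflections (suc t) (φ ∘ ((true , a) ∙_)))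
      ≡⟨ sumFin-cong M (λ a → trans (sumOverTuples-reflections t (φ ∘ ((true , a) ∙_)))
                                     (cong (M ^ t *_) (cosetSum-reflection∙ a (productCoset t) φ))) ⟩
    sumFin M (λ _ → M ^ t * cosetSum (productCoset (suc t)) φ)
      ≡⟨ sumFin-const M (M ^ t * cosetSum (productCoset (suc t)) φ) ⟩
    M * (M ^ t * cosetSum (productCoset (suc t)) φ)
      ≡⟨ *-assoc M (M ^ t) _ ⟨
    M ^ suc t * cosetSum (productCoset (suc t)) φ ∎
    where open ≡-Reasoning

  -- The Coxeter length

  -- Left multiplication by σ₁ resp. σ₂ acts on pos as p ↦ 1 - p resp. p ↦ -1 - p modulo 2M,
  -- so it changes dist by one; dist turns out to be the Coxeter length.
  pos : G → ℕ
  pos (false , k) = toℕ k + toℕ k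
  pos (true  , k) = suc (toℕ k + toℕ k)

  dist : G → ℕ
  dist x = cycleDist (M + M) (pos x)

  pos<2M : ∀ x → pos x < M + M
  pos<2M (false , k) = +-mono-< (toℕ<n k) (toℕ<n k)
  pos<2M (true  , k) = +-mono-≤-< (toℕ<n k) (toℕ<n k)

  pos≡0⇒≡e : ∀ x → pos x ≡ 0 → x ≡ e M
  pos≡0⇒≡e (false , fzero)  _  = refl
  pos≡0⇒≡e (false , fsuc _) ()
  pos≡0⇒≡e (true  , _)      ()

  toℕ-mirror-σ₁-zero : toℕ (mirror (proj₂ σ₁) fzero) ≡ 0
  toℕ-mirror-σ₁-zero = trans (toℕ-md M) (n%n≡0 M)

  toℕ-mirror-σ₁-suc : ∀ j → toℕ (mirror (proj₂ σ₁) (fsuc j)) ≡ M ∸ suc (toℕ j)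
  toℕ-mirror-σ₁-suc j = toℕ-md-< (∸-monoʳ-< {o = 0} z<s (<⇒≤ (toℕ<n (fsuc j))))

  toℕ-mirror-σ₂ : ∀ k → toℕ (mirror (proj₂ σ₂) k) ≡ suc n ∸ toℕ k
  toℕ-mirror-σ₂ k = begin
    toℕ (md (toℕ (proj₂ σ₂) + (M ∸ toℕ k))) ≡⟨ toℕ-md (toℕ (proj₂ σ₂) + (M ∸ toℕ k)) ⟩
    (toℕ (proj₂ σ₂) + (M ∸ toℕ k)) % M      ≡⟨ cong (λ z → (z + (M ∸ toℕ k)) % M) toℕ-σ₂ ⟩
    (suc n + (M ∸ toℕ k)) % M               ≡⟨ cong (_% M) shift-by-M ⟩
    (suc n ∸ toℕ k + M) % M                 ≡⟨ [m+n]%n≡m%n (suc n ∸ toℕ k) M ⟩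
    (suc n ∸ toℕ k) % M                     ≡⟨ m<n⇒m%n≡m (s≤s (m∸n≤m (suc n) (toℕ k))) ⟩
    suc n ∸ toℕ k                           ∎
    where
    open ≡-Reasoning
    k≤1+n : toℕ k ≤ suc n
    k≤1+n = s≤s⁻¹ (toℕ<n k)
    shift-by-M : suc n + (M ∸ toℕ k) ≡ suc n ∸ toℕ k + M
    shift-by-M = begin
      suc n + (M ∸ toℕ k) ≡⟨ +-∸-assoc (suc n) (≤-trans k≤1+n (n≤1+n (suc n))) ⟨
      suc n + M ∸ toℕ k   ≡⟨ cong (_∸ toℕ k) (+-comm (suc n) M) ⟩
      M + suc n ∸ toℕ k   ≡⟨ +-∸-assoc M k≤1+n ⟩
      M + (suc n ∸ toℕ k) ≡⟨ +-comm M _ ⟩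
      suc n ∸ toℕ k + M   ∎

  M∸k+k≡M : ∀ (k : Fin M) → M ∸ toℕ k + toℕ k ≡ M
  M∸k+k≡M k = m∸n+n≡m (<⇒≤ (toℕ<n k))

  1+n∸k+k≡1+n : ∀ (k : Fin M) → suc n ∸ toℕ k + toℕ k ≡ suc n
  1+n∸k+k≡1+n k = m∸n+n≡m (s≤s⁻¹ (toℕ<n k))

  dist-σ₁∙e : dist (σ₁ ∙ e M) ≡ 1
  dist-σ₁∙e rewrite toℕ-mirror-σ₁-zero = refl

  dist-σ₁∙ : ∀ x → 0 < pos x → dist (σ₁ ∙ x) ≡ cycleDist (M + M) (pred (pos x))
  dist-σ₁∙ (false , fsuc j) _ rewrite toℕ-mirror-σ₁-suc j =
    cycleDist-sym (trans (regroup (M ∸ suc (toℕ j)) (toℕ j)) (cong (λ z → z + z) (M∸k+k≡M (fsuc j))))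
    where
    regroup : ∀ i j → suc (i + i) + (j + suc j) ≡ (i + suc j) + (i + suc j)
    regroup = solve-∀
  dist-σ₁∙ (true , fzero) _ rewrite toℕ-mirror-σ₁-zero = refl
  dist-σ₁∙ (true , fsuc j) _ rewrite toℕ-mirror-σ₁-suc j =
    cycleDist-sym (trans (regroup (M ∸ suc (toℕ j)) (toℕ j)) (cong (λ z → z + z) (M∸k+k≡M (fsuc j))))
    where
    regroup : ∀ i j → i + i + (suc j + suc j) ≡ (i + suc j) + (i + suc j)
    regroup = solve-∀

  dist-σ₂∙ : ∀ x → dist (σ₂ ∙ x) ≡ cycleDist (M + M) (suc (pos x))
  dist-σ₂∙ (false , k) rewrite toℕ-mirror-σ₂ k =
    cycleDist-sym (trans (regroup (suc n ∸ toℕ k) (toℕ k)) (cong (λ z → suc z + suc z) (1+n∸k+k≡1+n k)))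
    where
    regroup : ∀ i k → suc (i + i) + suc (k + k) ≡ suc (i + k) + suc (i + k)
    regroup = solve-∀
  dist-σ₂∙ (true , k) rewrite toℕ-mirror-σ₂ k =
    cycleDist-sym (trans (regroup (suc n ∸ toℕ k) (toℕ k)) (cong (λ z → suc z + suc z) (1+n∸k+k≡1+n k)))
    where
    regroup : ∀ i k → i + i + suc (suc (k + k)) ≡ suc (i + k) + suc (i + k)
    regroup = solve-∀

  dist-σ₁∙-≤ : ∀ x → dist (σ₁ ∙ x) ≤ suc (dist x)
  dist-σ₁∙-≤ (false , fzero)    = ≤-reflexive dist-σ₁∙e
  dist-σ₁∙-≤ x@(false , fsuc _) =
    subst (_≤ suc (dist x)) (sym (dist-σ₁∙ x z<s)) (cycleDist-≤-suc (pred (pos x)))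
  dist-σ₁∙-≤ x@(true , _) =
    subst (_≤ suc (dist x)) (sym (dist-σ₁∙ x z<s)) (cycleDist-≤-suc (pred (pos x)))

  dist-σ₂∙-≤ : ∀ x → dist (σ₂ ∙ x) ≤ suc (dist x)
  dist-σ₂∙-≤ x = subst (_≤ suc (dist x)) (sym (dist-σ₂∙ x)) (cycleDist-suc-≤ (pos x))

  mirror-σ₁-involutive : ∀ k → mirror (proj₂ σ₁) (mirror (proj₂ σ₁) k) ≡ k
  mirror-σ₁-involutive fzero = trans (cong (mirror (proj₂ σ₁)) fixed) fixed
    where
    fixed : mirror (proj₂ σ₁) fzero ≡ fzero
    fixed = toℕ-injective toℕ-mirror-σ₁-zero
  mirror-σ₁-involutive (fsuc j) = toℕ-injective (begin
    toℕ (md (M ∸ toℕ (mirror (proj₂ σ₁) (fsuc j)))) ≡⟨ cong (toℕ ∘ md ∘ (M ∸_)) (toℕ-mirror-σ₁-suc j) ⟩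
    toℕ (md (M ∸ (M ∸ suc (toℕ j))))               ≡⟨ cong (toℕ ∘ md) (m∸[m∸n]≡n (<⇒≤ (toℕ<n (fsuc j)))) ⟩
    toℕ (md (suc (toℕ j)))                         ≡⟨ toℕ-md-< (toℕ<n (fsuc j)) ⟩
    suc (toℕ j)                                    ∎)
    where open ≡-Reasoning

  mirror-σ₂-involutive : ∀ k → mirror (proj₂ σ₂) (mirror (proj₂ σ₂) k) ≡ k
  mirror-σ₂-involutive k = toℕ-injective (begin
    toℕ (mirror (proj₂ σ₂) (mirror (proj₂ σ₂) k)) ≡⟨ toℕ-mirror-σ₂ (mirror (proj₂ σ₂) k) ⟩
    suc n ∸ toℕ (mirror (proj₂ σ₂) k)             ≡⟨ cong (suc n ∸_) (toℕ-mirror-σ₂ k) ⟩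
    suc n ∸ (suc n ∸ toℕ k)                       ≡⟨ m∸[m∸n]≡n (s≤s⁻¹ (toℕ<n k)) ⟩
    toℕ k                                         ∎)
    where open ≡-Reasoning

  σ₁∙-involutive : ∀ x → σ₁ ∙ (σ₁ ∙ x) ≡ x
  σ₁∙-involutive (false , k) = cong (false ,_) (mirror-σ₁-involutive k)
  σ₁∙-involutive (true  , k) = cong (true  ,_) (mirror-σ₁-involutive k)

  σ₂∙-involutive : ∀ x → σ₂ ∙ (σ₂ ∙ x) ≡ x
  σ₂∙-involutive (false , k) = cong (false ,_) (mirror-σ₂-involutive k)
  σ₂∙-involutive (true  , k) = cong (true  ,_) (mirror-σ₂-involutive k)

  dist-evalWord-≤ : ∀ ws → dist (evalWord M ws) ≤ length ws
  dist-evalWord-≤ []            = z≤n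
  dist-evalWord-≤ (fzero  ∷ ws) = ≤-trans (dist-σ₁∙-≤ (evalWord M ws)) (s≤s (dist-evalWord-≤ ws))
  dist-evalWord-≤ (fsuc _ ∷ ws) = ≤-trans (dist-σ₂∙-≤ (evalWord M ws)) (s≤s (dist-evalWord-≤ ws))

  word-of-dist : ∀ d x → dist x ≡ d → ∃ λ ws → evalWord M ws ≡ x × length ws ≡ d
  word-of-dist zero x dist≡0 = [] , sym (pos≡0⇒≡e x (cycleDist≡0⇒≡0 (pos<2M x) dist≡0)) , refl
  word-of-dist (suc d) x dist≡ with cycleDist-descent (pos x) d dist≡
  ... | inj₁ down with word-of-dist d (σ₁ ∙ x) (trans (dist-σ₁∙ x (cycleDist≡suc⇒0< dist≡)) down)
  ...   | ws , ws↦σ₁x , |ws|≡d =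
    fzero ∷ ws , trans (cong (σ₁ ∙_) ws↦σ₁x) (σ₁∙-involutive x) , cong suc |ws|≡d
  word-of-dist (suc d) x dist≡ | inj₂ up with word-of-dist d (σ₂ ∙ x) (trans (dist-σ₂∙ x) up)
  ...   | ws , ws↦σ₂x , |ws|≡d =
    fsuc fzero ∷ ws , trans (cong (σ₂ ∙_) ws↦σ₂x) (σ₂∙-involutive x) , cong suc |ws|≡d

  coxeterLength≡dist : ∀ ℓ → IsCoxeterLength M ℓ → ∀ x → ℓ x ≡ dist x
  coxeterLength≡dist ℓ isLength x with isLength x | word-of-dist (dist x) x refl
  ... | (ws , ws↦x , |ws|≡ℓx) , minimal | vs , vs↦x , |vs|≡dist =
    ≤-antisym (subst (ℓ x ≤_) |vs|≡dist (minimal vs vs↦x))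
              (subst₂ _≤_ (cong dist ws↦x) |ws|≡ℓx (dist-evalWord-≤ ws))

  length-reflections : length reflections ≡ M
  length-reflections = trans (length-map {B = G} (true ,_) (allFin M)) (length-tabulate {n = M} id)

  E-reflections : ∀ t φ → E _∙_ (e M) (T M) φ (suc t) ≡ (ℤ.+ cosetSum (productCoset t) φ) / M
  E-reflections t φ = begin
    E _∙_ (e M) (T M) φ (suc t)
      ≡⟨ cong (λ R → E _∙_ (e M) R φ (suc t)) T≡reflections ⟩
    divℕ (ℤ.+ sumOverTuples _∙_ (e M) reflections (suc t) φ) (length reflections ^ suc t)
      ≡⟨ cong₂ (λ a b → divℕ (ℤ.+ a) (b ^ suc t)) (sumOverTuples-reflections t φ) length-reflections ⟩
    divℕ (ℤ.+ (M ^ t * cosetSum (productCoset t) φ)) (M * M ^ t)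
      ≡⟨ divℕ-cancelʳ (cosetSum (productCoset t) φ) M (M ^ t) {{m^n≢0 M t}} ⟩
    (ℤ.+ cosetSum (productCoset t) φ) / M ∎
    where open ≡-Reasoning

  cosetSum-dist-rotations : cosetSum false dist ≡ rotationDistSum M
  cosetSum-dist-rotations = sumFin-toℕ M (λ i → cycleDist (M + M) (i + i))

  cosetSum-dist-reflections : cosetSum true dist ≡ reflectionDistSum M
  cosetSum-dist-reflections = sumFin-toℕ M (λ i → cycleDist (M + M) (suc (i + i)))

  cosetSum-dist-even : M % 2 ≡ 0 → ∀ b → cosetSum b dist * 2 ≡ M * M
  cosetSum-dist-even M%2≡0 false = begin
    cosetSum false dist * 2           ≡⟨ cong (_* 2) cosetSum-dist-rotations ⟩
    rotationDistSum M * 2             ≡⟨ +-identityʳ _ ⟨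
    rotationDistSum M * 2 + 0         ≡⟨ cong (rotationDistSum M * 2 +_) M%2≡0 ⟨
    rotationDistSum M * 2 + M % 2     ≡⟨ rotationDistSum-closed M ⟩
    M * M                             ∎
    where open ≡-Reasoning
  cosetSum-dist-even M%2≡0 true = begin
    cosetSum true dist * 2            ≡⟨ cong (_* 2) cosetSum-dist-reflections ⟩
    reflectionDistSum M * 2           ≡⟨ reflectionDistSum-closed M ⟩
    M * M + M % 2                     ≡⟨ cong (M * M +_) M%2≡0 ⟩
    M * M + 0                         ≡⟨ +-identityʳ _ ⟩
    M * M                             ∎
    where open ≡-Reasoning

  cosetSum-dist-odd : M % 2 ≡ 1 → ∀ t →
    (ℤ.+ cosetSum (productCoset t) dist) / M ≡ (ℤ.+ M) / 2 ℚ.- ((-1ℤ ℤ.^ suc t) / 2) ℚ.* (1ℤ / M)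
  cosetSum-dist-odd M%2≡1 t with productCoset-sign t
  ... | inj₁ (coset≡true , sign≡) rewrite coset≡true | sign≡ =
    half-square-shifted (cosetSum true dist) M 0 1 (begin
      cosetSum true dist * 2 + 0  ≡⟨ +-identityʳ _ ⟩
      cosetSum true dist * 2      ≡⟨ cong (_* 2) cosetSum-dist-reflections ⟩
      reflectionDistSum M * 2     ≡⟨ reflectionDistSum-closed M ⟩
      M * M + M % 2               ≡⟨ cong (M * M +_) M%2≡1 ⟩
      M * M + 1                   ∎)
    where open ≡-Reasoning
  ... | inj₂ (coset≡false , sign≡) rewrite coset≡false | sign≡ =
    half-square-shifted (cosetSum false dist) M 1 0 (begin
      cosetSum false dist * 2 + 1   ≡⟨ cong (λ X → X * 2 + 1) cosetSum-dist-rotations ⟩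
      rotationDistSum M * 2 + 1     ≡⟨ cong (rotationDistSum M * 2 +_) M%2≡1 ⟨
      rotationDistSum M * 2 + M % 2 ≡⟨ rotationDistSum-closed M ⟩
      M * M                         ≡⟨ +-identityʳ _ ⟨
      M * M + 0                     ∎)
    where open ≡-Reasoning

open import Defs
open import Data.Nat using (ℕ; _≤_; NonZero; suc; s≤s; z≤n)
open import Data.Nat.Divisibility using (_∣_; n∣m⇒m%n≡0)
open import Data.Integer using (+_; -1ℤ; 1ℤ) renaming (_^_ to _^ℤ_)
open import Data.Rational using (_/_; _-_; _*_)
open import Data.Product using (_×_; _,_)
open import Relation.Nullary using (¬_)
open import Relation.Binary.PropositionalEquality using (_≡_; trans; cong)
open Fractions using (half-square)
open Parity using (productCoset; odd⇒%2≡1)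

mainTheorem1 : (m : ℕ) .{{_ : NonZero m}} → 2 ≤ m → (t : ℕ) → 1 ≤ t →
    (ℓ : I2 m → ℕ) → IsCoxeterLength m ℓ →
      (2 ∣ m → E (_·_ m) (e m) (T m) ℓ t ≡ (+ m) / 2)
      × (¬ 2 ∣ m → E (_·_ m) (e m) (T m) ℓ t ≡ (+ m) / 2 - (((-1ℤ ^ℤ t) / 2) * (1ℤ / m)))
mainTheorem1 (suc (suc n)) (s≤s (s≤s z≤n)) (suc t) (s≤s z≤n) ℓ isLength = even , odd
  where
  open Dihedral n
  E≡ : E _∙_ (e M) (T M) ℓ (suc t) ≡ (+ cosetSum (productCoset t) dist) / M
  E≡ = trans (E-reflections t ℓ)
             (cong (λ X → (+ X) / M) (cosetSum-cong (productCoset t) (coxeterLength≡dist ℓ isLength)))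
  even : 2 ∣ M → E _∙_ (e M) (T M) ℓ (suc t) ≡ (+ M) / 2
  even 2∣M = trans E≡ (half-square (cosetSum (productCoset t) dist) M
                                    (cosetSum-dist-even (n∣m⇒m%n≡0 M 2 2∣M) (productCoset t)))
  odd : ¬ 2 ∣ M → E _∙_ (e M) (T M) ℓ (suc t) ≡ (+ M) / 2 - ((-1ℤ ^ℤ suc t) / 2) * (1ℤ / M)
  odd 2∤M = trans E≡ (cosetSum-dist-odd (odd⇒%2≡1 M 2∤M) t)
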